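{- Let $p\ge1$ and $n\ge2$ be integers and let $\mathbf{H}$ be the set of graphs on $n$ vertices of maximum degree $n-1$. Then \[ f_{pK_2\cup\mathbf{H}}(\omega)={\omega+2p-2 \choose 2p-1}+(n-1){\omega+2p-2 \choose 2p} \] is a $\chi$-bounding function for the $(pK_2\cup\mathbf{H})$-free graphs.
   Context: A graph is $\mathbf{H}$-free if it has no induced subgraph isomorphic to a member of $\mathbf{H}$. $f$ is a $\chi$-bounding function for a class if $\chi(G)\le f(\omega(G))$ for all $G$ in the class. $pK_2$ is the disjoint union of $p$ edges and $pK_2\cup\mathbf{H}=\{pK_2\cup H:H\in\mathbf{H}\}$. -}

module Defs where

open import Data.Nat using (ℕ; zero; suc; _+_; _*_; _∸_; _≤_; _<_; _⊔_)
open import Data.Nat.Combinatorics using (_C_)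
open import Data.Bool using (Bool; true; false; if_then_else_)
open import Data.Fin using (Fin; zero; suc; splitAt)
open import Data.Sum using (_⊎_; inj₁; inj₂)
open import Data.Product using (Σ; _×_; ∃; _,_)
open import Data.List using (List; map; foldr; allFin)
open import Data.Nat.ListAction using (sum)
open import Relation.Binary.PropositionalEquality using (_≡_; refl)
open import Relation.Nullary using (¬_)
open import Function.Definitions using (Injective)

record Graph (n : ℕ) : Set where
  field
    adj    : Fin n → Fin n → Bool
    sym    : ∀ i j → adj i j ≡ adj j i
    irrefl : ∀ i → adj i i ≡ false
open Graph public

module _ {a b : ℕ} (G : Graph a) (H : Graph b) where
  private
    adjS : Fin a ⊎ Fin b → Fin a ⊎ Fin b → Bool
    adjS (inj₁ x) (inj₁ y) = adj G x y
    adjS (inj₂ x) (inj₂ y) = adj H x y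
    adjS (inj₁ _) (inj₂ _) = false
    adjS (inj₂ _) (inj₁ _) = false

    adjS-sym : ∀ x y → adjS x y ≡ adjS y x
    adjS-sym (inj₁ x) (inj₁ y) = sym G x y
    adjS-sym (inj₂ x) (inj₂ y) = sym H x y
    adjS-sym (inj₁ _) (inj₂ _) = refl
    adjS-sym (inj₂ _) (inj₁ _) = refl

    adjS-irr : ∀ x → adjS x x ≡ false
    adjS-irr (inj₁ x) = irrefl G x
    adjS-irr (inj₂ x) = irrefl H x

  _∪G_ : Graph (a + b)
  _∪G_ = record
    { adj    = λ i j → adjS (splitAt a i) (splitAt a j)
    ; sym    = λ i j → adjS-sym (splitAt a i) (splitAt a j)
    ; irrefl = λ i → adjS-irr (splitAt a i) }

K0 : Graph 0
K0 = record { adj = λ () ; sym = λ () ; irrefl = λ () }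

K2 : Graph 2
K2 = record { adj = e ; sym = s ; irrefl = r }
  where
  e : Fin 2 → Fin 2 → Bool
  e zero (suc zero) = true
  e (suc zero) zero = true
  e _ _ = false
  s : ∀ i j → e i j ≡ e j i
  s zero zero = refl
  s zero (suc zero) = refl
  s (suc zero) zero = refl
  s (suc zero) (suc zero) = refl
  r : ∀ i → e i i ≡ false
  r zero = refl
  r (suc zero) = refl

twice : ℕ → ℕ
twice zero = zero
twice (suc p) = 2 + twice p

pK2 : (p : ℕ) → Graph (twice p)
pK2 zero = K0
pK2 (suc p) = K2 ∪G pK2 p

degree : ∀ {n} → Graph n → Fin n → ℕ
degree {n} G v = sum (map (λ j → if adj G v j then 1 else 0) (allFin n))

maxDegree : ∀ {n} → Graph n → ℕ
maxDegree {n} G = foldr _⊔_ 0 (map (degree G) (allFin n))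

InducedSub : ∀ {h m} → Graph h → Graph m → Set
InducedSub {h} {m} H G =
  Σ (Fin h → Fin m) λ φ → Injective _≡_ _≡_ φ × (∀ i j → adj G (φ i) (φ j) ≡ adj H i j)

PK2HFree : (p n : ℕ) → ∀ {m} → Graph m → Set
PK2HFree p n G = (H : Graph n) → maxDegree H ≡ n ∸ 1 → ¬ InducedSub (pK2 p ∪G H) G

HasClique : ∀ {m} → Graph m → ℕ → Set
HasClique {m} G k =
  Σ (Fin k → Fin m) λ φ → Injective _≡_ _≡_ φ × (∀ i j → ¬ i ≡ j → adj G (φ i) (φ j) ≡ true)

IsCliqueNumber : ∀ {m} → Graph m → ℕ → Set
IsCliqueNumber G w = HasClique G w × (∀ k → w < k → ¬ HasClique G k)

Colorable : ∀ {m} → Graph m → ℕ → Set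
Colorable {m} G k = Σ (Fin m → Fin k) λ c → ∀ i j → adj G i j ≡ true → ¬ c i ≡ c j

fBound : (p n w : ℕ) → ℕ
fBound p n w = ((w + 2 * p ∸ 2) C (2 * p ∸ 1)) + (n ∸ 1) * ((w + 2 * p ∸ 2) C (2 * p))

-- For p = 0 a vertex with n − 1 neighbours would be the centre of an induced member of 𝐇,
-- so all degrees are below n − 1 and greedy colouring uses n − 1 colours. For p ≥ 1 induct on
-- ω: pick a vertex q of a maximum clique; its neighbours have clique number ω − 1. Its
-- non-neighbours are split along the vertices r of the (ω − 1)-clique in N(q), one at a time:
-- those adjacent to neither q nor r are ((p − 1)K₂ ∪ 𝐇)-free, since qr is an induced K₂
-- anticomplete to them, and those adjacent to r are treated inside N(r). The resulting
-- recurrences are Pascal's rule and yield the binomial bound.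
module Submission where

open import Defs hiding (sym)
open import Data.Nat as ℕ using (ℕ; zero; suc; _+_; _*_; _∸_; _≤_; _<_; z≤n; s≤s)
open import Data.Nat.Properties
open import Data.Nat.Combinatorics using (_C_; nCn≡1; nC1≡n; k>n⇒nCk≡0; nCk+nC[k+1]≡[n+1]C[k+1])
open import Data.Nat.Tactic.RingSolver using (solve-∀)
open import Data.Nat.ListAction using (sum)
open import Data.Bool as Bool using (Bool; true; false; if_then_else_)
open import Data.Fin using (Fin; zero; suc; toℕ; fromℕ<; splitAt)
import Data.Fin.Properties as Fin
open import Data.Vec.Functional using (_∷_)
open import Data.Sum as Sum using (_⊎_; inj₁; inj₂; [_,_]′)
open import Data.Product as Product using (Σ; ∃; _×_; _,_; proj₁; proj₂)
open import Data.Empty using (⊥-elim)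
open import Data.Unit using (⊤; tt)
open import Data.List using (tabulate)
open import Data.List.Properties using (map-tabulate; foldr-preservesᵇ; foldr-preservesᵒ)
import Data.List.Relation.Unary.All.Properties as All
import Data.List.Relation.Unary.Any as Any
open import Data.List.Membership.Propositional.Properties using (∈-map⁺; ∈-allFin)
open import Relation.Binary.PropositionalEquality
open import Relation.Nullary using (¬_; Dec; yes; no; does; _×-dec_)
open import Relation.Unary using (Pred; Decidable; _∈_; _⊆_; _∩_; U)
open import Relation.Unary.Properties using (_∩?_; U?)
open import Level using (0ℓ)
open import Function.Definitions using (Injective)

module ColourBound (N : ℕ) where

  -- bound p w colours a (pK₂ ∪ 𝐇)-free set without (w + 1)-cliques; nonNeighbourBound p l
  -- colours the non-neighbours of a vertex q whose neighbourhood contains an l-clique.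
  mutual
    bound : ℕ → ℕ → ℕ
    bound zero    w       = N
    bound (suc p) zero    = 0
    bound (suc p) (suc w) = bound (suc p) w + nonNeighbourBound p w

    nonNeighbourBound : ℕ → ℕ → ℕ
    nonNeighbourBound p zero    = 1
    nonNeighbourBound p (suc l) = nonNeighbourBound p l + bound p (suc (suc l))

  binom₂ : ℕ → ℕ → ℕ
  binom₂ k x = x C k + N * (x C suc k)

  binom₂-pascal : ∀ k x → binom₂ (suc k) x + binom₂ k x ≡ binom₂ (suc k) (suc x)
  binom₂-pascal k x = begin
      (b + N * c) + (a + N * b) ≡⟨ regroup a b c N ⟩
      (a + b) + N * (b + c)     ≡⟨ cong₂ (λ s t → s + N * t) (pascal x k) (pascal x (suc k)) ⟩
      binom₂ (suc k) (suc x)    ∎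
    where
    open ≡-Reasoning
    pascal = nCk+nC[k+1]≡[n+1]C[k+1]
    a = x C k
    b = x C suc k
    c = x C suc (suc k)
    regroup : ∀ a b c N → (b + N * c) + (a + N * b) ≡ (a + b) + N * (b + c)
    regroup = solve-∀

  binom₂-below : ∀ k → binom₂ (suc k) k ≡ 0
  binom₂-below k rewrite k>n⇒nCk≡0 (≤-refl {suc k}) | k>n⇒nCk≡0 (m≤n+m (suc k) 1) = *-zeroʳ N

  binom₂-diagonal : ∀ k → binom₂ k k ≡ 1
  binom₂-diagonal k rewrite nCn≡1 k | k>n⇒nCk≡0 (≤-refl {suc k}) | *-zeroʳ N = refl

  twice-suc : ∀ l p → l + (suc p + suc p) ≡ suc (suc (l + (p + p)))
  twice-suc = solve-∀

  mutual
    bound-closedForm : ∀ p w → bound (suc p) w ≡ binom₂ (suc (p + p)) (w + (p + p))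
    bound-closedForm p zero    = sym (binom₂-below (p + p))
    bound-closedForm p (suc w) = begin
        bound (suc p) w + nonNeighbourBound p w
      ≡⟨ cong₂ _+_ (bound-closedForm p w) (nonNeighbourBound-closedForm p w) ⟩
        binom₂ (suc e) (w + e) + binom₂ e (w + e)
      ≡⟨ binom₂-pascal e (w + e) ⟩
        binom₂ (suc e) (suc w + e)
      ∎
      where
      open ≡-Reasoning
      e = p + p

    nonNeighbourBound-closedForm : ∀ p l → nonNeighbourBound p l ≡ binom₂ (p + p) (l + (p + p))
    nonNeighbourBound-closedForm p zero = sym (binom₂-diagonal (p + p))
    nonNeighbourBound-closedForm zero (suc l)
      rewrite nonNeighbourBound-closedForm zero l | +-identityʳ l | nC1≡n l | nC1≡n (suc l) = shift l N
      where
      shift : ∀ l N → (1 + N * l) + N ≡ 1 + N * suc l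
      shift = solve-∀
    nonNeighbourBound-closedForm (suc p) (suc l) = begin
        nonNeighbourBound (suc p) l + bound (suc p) (suc (suc l))
      ≡⟨ cong₂ _+_ (nonNeighbourBound-closedForm (suc p) l) (bound-closedForm p (suc (suc l))) ⟩
        binom₂ (suc p + suc p) (l + (suc p + suc p)) + binom₂ (suc e) (suc (suc l) + e)
      ≡⟨ cong₂ (λ k x → binom₂ k x + binom₂ (suc e) (suc (suc l) + e)) (twice-suc 0 p) (twice-suc l p) ⟩
        binom₂ (suc (suc e)) (suc (suc l) + e) + binom₂ (suc e) (suc (suc l) + e)
      ≡⟨ binom₂-pascal (suc e) (suc (suc l) + e) ⟩
        binom₂ (suc (suc e)) (suc (suc (suc l) + e))
      ≡⟨ cong₂ binom₂ (sym (twice-suc 0 p)) (sym (twice-suc (suc l) p)) ⟩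
        binom₂ (suc p + suc p) (suc l + (suc p + suc p))
      ∎
      where
      open ≡-Reasoning
      e = p + p

  fBound≡bound : ∀ p w → fBound (suc p) (suc N) w ≡ bound (suc p) w
  fBound≡bound p w = begin
      fBound (suc p) (suc N) w
    ≡⟨ cong₂ (λ x k → x C k + N * (x C suc k))
             (cong (_∸ 2) (double-suc w p)) (cong (_∸ 1) (double-suc 0 p)) ⟩
      binom₂ (suc (p + p)) (w + (p + p))
    ≡⟨ sym (bound-closedForm p w) ⟩
      bound (suc p) w
    ∎
    where
    open ≡-Reasoning
    double-suc : ∀ l p → l + 2 * suc p ≡ suc (suc (l + (p + p)))
    double-suc = solve-∀

indicator : Bool → ℕ
indicator b = if b then 1 else 0

indicator≤1 : ∀ b → indicator b ≤ 1
indicator≤1 true  = ≤-refl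
indicator≤1 false = z≤n

sum-tabulate-≤ : ∀ k (f : Fin k → ℕ) → (∀ j → f j ≤ 1) → sum (tabulate f) ≤ k
sum-tabulate-≤ zero    f f≤1 = z≤n
sum-tabulate-≤ (suc k) f f≤1 =
  +-mono-≤ (f≤1 zero) (sum-tabulate-≤ k (λ j → f (suc j)) (λ j → f≤1 (suc j)))

sum-tabulate-≤-if-zero : ∀ k (f : Fin (suc k) → ℕ) → (∀ j → f j ≤ 1) →
  ∀ i → f i ≡ 0 → sum (tabulate f) ≤ k
sum-tabulate-≤-if-zero k       f f≤1 zero    fi≡0 rewrite fi≡0 =
  sum-tabulate-≤ k (λ j → f (suc j)) (λ j → f≤1 (suc j))
sum-tabulate-≤-if-zero (suc k) f f≤1 (suc i) fi≡0 =
  +-mono-≤ (f≤1 zero) (sum-tabulate-≤-if-zero k (λ j → f (suc j)) (λ j → f≤1 (suc j)) i fi≡0)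

sum-tabulate-≡ : ∀ k (f : Fin k → ℕ) → (∀ j → f j ≡ 1) → sum (tabulate f) ≡ k
sum-tabulate-≡ zero    f f≡1 = refl
sum-tabulate-≡ (suc k) f f≡1 =
  cong₂ _+_ (f≡1 zero) (sum-tabulate-≡ k (λ j → f (suc j)) (λ j → f≡1 (suc j)))

degree≡sum-tabulate : ∀ {k} (F : Graph k) v → degree F v ≡ sum (tabulate (λ j → indicator (adj F v j)))
degree≡sum-tabulate F v = cong sum (map-tabulate (λ j → j) (λ j → indicator (adj F v j)))

degree-≤ : ∀ {k} (F : Graph (suc k)) v → degree F v ≤ k
degree-≤ {k} F v rewrite degree≡sum-tabulate F v =
  sum-tabulate-≤-if-zero k _ (λ j → indicator≤1 (adj F v j)) v (cong indicator (irrefl F v))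

maxDegree≡ : ∀ {k} (F : Graph (suc k)) v → degree F v ≡ k → maxDegree F ≡ k
maxDegree≡ {k} F v deg≡k = ≤-antisym
  (foldr-preservesᵇ {P = _≤ k} ⊔-lub z≤n (All.map⁺ (All.tabulate⁺ (degree-≤ F))))
  (foldr-preservesᵒ {P = k ≤_} (λ x y → [ m≤n⇒m≤n⊔o y , m≤n⇒m≤o⊔n x ]′) 0 _
    (inj₂ (Any.map (λ eq → subst (k ≤_) eq (≤-reflexive (sym deg≡k))) (∈-map⁺ (degree F) (∈-allFin v)))))

module _ {a n} (F : Graph a) (H : Graph n) where

  adj-K2∪-shift : ∀ i j → adj ((K2 ∪G F) ∪G H) (suc (suc i)) (suc (suc j)) ≡ adj (F ∪G H) i j
  adj-K2∪-shift i j with splitAt a i | splitAt a j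
  ... | inj₁ _ | inj₁ _ = refl
  ... | inj₁ _ | inj₂ _ = refl
  ... | inj₂ _ | inj₁ _ = refl
  ... | inj₂ _ | inj₂ _ = refl

  adj-K2∪-0 : ∀ i → adj ((K2 ∪G F) ∪G H) zero (suc (suc i)) ≡ false
  adj-K2∪-0 i with splitAt a i
  ... | inj₁ _ = refl
  ... | inj₂ _ = refl

  adj-K2∪-1 : ∀ i → adj ((K2 ∪G F) ∪G H) (suc zero) (suc (suc i)) ≡ false
  adj-K2∪-1 i with splitAt a i
  ... | inj₁ _ = refl
  ... | inj₂ _ = refl

module _ {m} (G : Graph m) where

  VSet : Set₁
  VSet = Pred (Fin m) 0ℓ

  nbr nonNbr : Fin m → VSet
  nbr    v u = adj G v u ≡ true
  nonNbr v u = adj G v u ≡ false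

  nbr? : ∀ v → Decidable (nbr v)
  nbr? v u = adj G v u Bool.≟ true

  nonNbr? : ∀ v → Decidable (nonNbr v)
  nonNbr? v u = adj G v u Bool.≟ false

  separated⇒distinct : ∀ {x u v} → adj G x u ≡ true → adj G x v ≡ false → u ≢ v
  separated⇒distinct xu xv refl with trans (sym xu) xv
  ... | ()

  adjacent⇒distinct : ∀ {u v} → adj G u v ≡ true → u ≢ v
  adjacent⇒distinct {u} uv u≡v = separated⇒distinct uv (irrefl G u) (sym u≡v)

  -- A k-clique in S, listed vertex by vertex: a vertex of S and a (k-1)-clique of S in its
  -- neighbourhood. This form is decidable and monotone by plain recursion on k.
  CliqueIn : VSet → ℕ → Set
  CliqueIn S zero    = ⊤
  CliqueIn S (suc k) = Σ (Fin m) λ v → v ∈ S × CliqueIn (S ∩ nbr v) k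

  CliqueIn-mono : ∀ {S T} k → S ⊆ T → CliqueIn S k → CliqueIn T k
  CliqueIn-mono zero    S⊆T _               = tt
  CliqueIn-mono (suc k) S⊆T (v , v∈S , K) = v , S⊆T v∈S , CliqueIn-mono k (Product.map₁ S⊆T) K

  cliqueIn? : ∀ {S} → Decidable S → ∀ k → Dec (CliqueIn S k)
  cliqueIn? S? zero    = yes tt
  cliqueIn? S? (suc k) = Fin.any? (λ v → S? v ×-dec cliqueIn? (S? ∩? nbr? v) k)

  CliqueIn⇒HasClique : ∀ {S} k → CliqueIn S k → HasClique G k
  CliqueIn⇒HasClique k K = proj₁ (vertices k K)
    where
    vertices : ∀ {S} k → CliqueIn S k → Σ (HasClique G k) λ K → ∀ i → proj₁ K i ∈ S
    vertices zero _ = ((λ ()) , (λ { {()} }) , (λ ())) , (λ ())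
    vertices {S} (suc k) (v , v∈S , K) with vertices k K
    ... | (ψ , ψ-injective , ψ-adjacent) , ψ∈ = (v ∷ ψ , injective , adjacent) , ∈S
      where
      injective : Injective _≡_ _≡_ (v ∷ ψ)
      injective {zero}  {zero}  _  = refl
      injective {zero}  {suc j} eq = ⊥-elim (adjacent⇒distinct (proj₂ (ψ∈ j)) eq)
      injective {suc i} {zero}  eq = ⊥-elim (adjacent⇒distinct (proj₂ (ψ∈ i)) (sym eq))
      injective {suc i} {suc j} eq = cong suc (ψ-injective eq)
      adjacent : ∀ i j → i ≢ j → adj G ((v ∷ ψ) i) ((v ∷ ψ) j) ≡ true
      adjacent zero    zero    i≢j = ⊥-elim (i≢j refl)
      adjacent zero    (suc j) _   = proj₂ (ψ∈ j)
      adjacent (suc i) zero    _   = trans (Graph.sym G (ψ i) v) (proj₂ (ψ∈ i))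
      adjacent (suc i) (suc j) i≢j = ψ-adjacent i j (λ eq → i≢j (cong suc eq))
      ∈S : ∀ i → (v ∷ ψ) i ∈ S
      ∈S zero    = v∈S
      ∈S (suc i) = proj₁ (ψ∈ i)

  -- Colours are natural numbers, so that a subset without vertices can be coloured with no
  -- colours; colours outside S are irrelevant.
  record Colouring (S : VSet) (k : ℕ) : Set where
    constructor colouring
    field
      colour  : Fin m → ℕ
      bounded : ∀ {u} → u ∈ S → colour u < k
      proper  : ∀ {u v} → u ∈ S → v ∈ S → adj G u v ≡ true → colour u ≢ colour v

  open Colouring

  Colouring-mono : ∀ {S T k} → T ⊆ S → Colouring S k → Colouring T k
  Colouring-mono T⊆S (colouring c c< c-proper) =
    colouring c (λ u∈T → c< (T⊆S u∈T)) (λ u∈T v∈T → c-proper (T⊆S u∈T) (T⊆S v∈T))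

  Colouring-weaken : ∀ {S k k′} → k ≤ k′ → Colouring S k → Colouring S k′
  Colouring-weaken k≤k′ (colouring c c< c-proper) =
    colouring c (λ u∈S → <-≤-trans (c< u∈S) k≤k′) c-proper

  Colouring-empty : ∀ {S k} → ¬ CliqueIn S 1 → Colouring S k
  Colouring-empty no-vertex = colouring (λ _ → 0)
    (λ {u} u∈S → ⊥-elim (no-vertex (u , u∈S , tt))) (λ {u} u∈S _ _ _ → no-vertex (u , u∈S , tt))

  Colouring-edgeless : ∀ {S} → ¬ CliqueIn S 2 → Colouring S 1
  Colouring-edgeless no-edge =
    colouring (λ _ → 0) (λ _ → s≤s z≤n)
      (λ {u} {v} u∈S v∈S uv _ → no-edge (u , u∈S , v , (v∈S , uv) , tt))

  Colouring-split : ∀ {S a b} v → Colouring (S ∩ nbr v) a → Colouring (S ∩ nonNbr v) b → Colouring S (a + b)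
  Colouring-split {S} {a} {b} v (colouring c₁ c₁< c₁-proper) (colouring c₂ c₂< c₂-proper) =
    colouring c c< c-proper
    where
    c : Fin m → ℕ
    c u = if adj G v u then c₁ u else a + c₂ u
    c< : ∀ {u} → u ∈ S → c u < a + b
    c< {u} u∈S with adj G v u in vu
    ... | true  = <-≤-trans (c₁< (u∈S , vu)) (m≤m+n a b)
    ... | false = +-monoʳ-< a (c₂< (u∈S , vu))
    c-proper : ∀ {u w} → u ∈ S → w ∈ S → adj G u w ≡ true → c u ≢ c w
    c-proper {u} {w} u∈S w∈S uw with adj G v u in vu | adj G v w in vw
    ... | true  | true  = c₁-proper (u∈S , vu) (w∈S , vw) uw
    ... | false | false = λ eq → c₂-proper (u∈S , vu) (w∈S , vw) uw (+-cancelˡ-≡ a _ _ eq)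
    ... | true  | false = λ eq → <-irrefl eq (<-≤-trans (c₁< (u∈S , vu)) (m≤m+n a (c₂ w)))
    ... | false | true  = λ eq → <-irrefl (sym eq) (<-≤-trans (c₁< (w∈S , vw)) (m≤m+n a (c₂ u)))

  Colouring-insert : ∀ {S T k} v x → x < k → (∀ {u} → u ∈ T → u ∈ S ⊎ u ≡ v) →
    (col : Colouring S k) → (∀ {u} → u ∈ S → adj G v u ≡ true → colour col u ≢ x) → Colouring T k
  Colouring-insert {S} {T} {k} v x x<k T⊆S∪v (colouring c c< c-proper) x-free = colouring c′ c′< c′-proper
    where
    c′ : Fin m → ℕ
    c′ u = if does (u Fin.≟ v) then x else c u
    c′< : ∀ {u} → u ∈ T → c′ u < k
    c′< {u} u∈T with u Fin.≟ v | T⊆S∪v u∈T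
    ... | yes _   | _          = x<k
    ... | no _    | inj₁ u∈S   = c< u∈S
    ... | no u≢v  | inj₂ u≡v   = ⊥-elim (u≢v u≡v)
    c′-proper : ∀ {u w} → u ∈ T → w ∈ T → adj G u w ≡ true → c′ u ≢ c′ w
    c′-proper {u} {w} u∈T w∈T uw with u Fin.≟ v | w Fin.≟ v | T⊆S∪v u∈T | T⊆S∪v w∈T
    ... | yes refl | yes refl | _        | _        = λ _ → adjacent⇒distinct uw refl
    ... | yes refl | no _     | _        | inj₁ w∈S = λ eq → x-free w∈S uw (sym eq)
    ... | no _     | yes refl | inj₁ u∈S | _        = x-free u∈S (trans (Graph.sym G w u) uw)
    ... | no _     | no _     | inj₁ u∈S | inj₁ w∈S = c-proper u∈S w∈S uw
    ... | no u≢v   | _        | inj₂ u≡v | _        = ⊥-elim (u≢v u≡v)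
    ... | _        | no w≢v   | _        | inj₂ w≡v = ⊥-elim (w≢v w≡v)

  HasNeighboursIn : VSet → Fin m → ℕ → Set
  HasNeighboursIn S v k = Σ (Fin k → Fin m) λ φ → Injective _≡_ _≡_ φ × (∀ i → φ i ∈ S ∩ nbr v)

  HasNeighboursIn-mono : ∀ {S T v k} → S ⊆ T → HasNeighboursIn S v k → HasNeighboursIn T v k
  HasNeighboursIn-mono S⊆T (φ , φ-injective , φ∈) = φ , φ-injective , λ i → Product.map₁ S⊆T (φ∈ i)

  Colouring-insert-sparse : ∀ {S T k} → Decidable S → ∀ v → ¬ HasNeighboursIn S v k →
    (∀ {u} → u ∈ T → u ∈ S ⊎ u ≡ v) → Colouring S k → Colouring T k
  Colouring-insert-sparse {S} {T} {k} S? v sparse T⊆S∪v col = choose (Fin.all? used?)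
    where
    Used : Fin k → Set
    Used x = ∃ λ u → u ∈ S ∩ nbr v × colour col u ≡ toℕ x
    used? : Decidable Used
    used? x = Fin.any? λ u → (S? ∩? nbr? v) u ×-dec (colour col u ℕ.≟ toℕ x)
    choose : Dec (∀ x → Used x) → Colouring T k
    choose (yes all-used) = ⊥-elim (sparse (φ , φ-injective , λ x → proj₁ (proj₂ (all-used x))))
      where
      φ : Fin k → Fin m
      φ x = proj₁ (all-used x)
      φ-injective : Injective _≡_ _≡_ φ
      φ-injective {x} {y} φx≡φy = Fin.toℕ-injective (begin
        toℕ x              ≡⟨ sym (proj₂ (proj₂ (all-used x))) ⟩
        colour col (φ x)   ≡⟨ cong (colour col) φx≡φy ⟩
        colour col (φ y)   ≡⟨ proj₂ (proj₂ (all-used y)) ⟩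
        toℕ y              ∎)
        where open ≡-Reasoning
    choose (no not-all-used) with Fin.¬∀⟶∃¬ k Used used? not-all-used
    ... | x , unused = Colouring-insert v (toℕ x) (Fin.toℕ<n x) T⊆S∪v col
                         (λ u∈S vu cu≡x → unused (_ , (u∈S , vu) , cu≡x))

  greedy-colouring : ∀ {S} → Decidable S → ∀ k →
    (∀ {v} → v ∈ S → ¬ HasNeighboursIn S v k) → Colouring S k
  greedy-colouring {S} S? k sparse = Colouring-mono (λ {u} u∈S → u∈S , Fin.toℕ<n u) (prefix m ≤-refl)
    where
    Below : ℕ → VSet
    Below j u = toℕ u < j
    below? : ∀ j → Decidable (Below j)
    below? j u = toℕ u ℕ.<? j
    prefix : ∀ j → j ≤ m → Colouring (S ∩ Below j) k
    prefix zero    _   = Colouring-empty λ { (_ , (_ , ()) , _) }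
    prefix (suc j) j<m = extend (S? v)
      where
      v = fromℕ< j<m
      below-suc : ∀ {u} → u ∈ S ∩ Below (suc j) → u ∈ S ∩ Below j ⊎ u ≡ v
      below-suc (u∈S , u<1+j) =
        Sum.map (u∈S ,_) (λ u≡j → Fin.toℕ-injective (trans u≡j (sym (Fin.toℕ-fromℕ< j<m))))
          (m<1+n⇒m<n∨m≡n u<1+j)
      extend : Dec (v ∈ S) → Colouring (S ∩ Below (suc j)) k
      extend (yes v∈S) = Colouring-insert-sparse (S? ∩? below? j) v
                           (λ nbrs → sparse v∈S (HasNeighboursIn-mono {S ∩ Below j} {S} proj₁ nbrs))
                           below-suc (prefix j (<⇒≤ j<m))
      extend (no v∉S)  = Colouring-mono
        (λ u∈ → [ (λ u∈′ → u∈′) , (λ u≡v → ⊥-elim (v∉S (subst S u≡v (proj₁ u∈)))) ]′ (below-suc u∈))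
        (prefix j (<⇒≤ j<m))

  record InducedCopy {k} (S : VSet) (F : Graph k) : Set where
    constructor inducedCopy
    field
      embed     : Fin k → Fin m
      injective : Injective _≡_ _≡_ embed
      preserves : ∀ i j → adj G (embed i) (embed j) ≡ adj F i j
      inside    : ∀ i → embed i ∈ S

  InducedCopy-mono : ∀ {k S T} {F : Graph k} → S ⊆ T → InducedCopy S F → InducedCopy T F
  InducedCopy-mono S⊆T (inducedCopy φ φ-injective φ-preserves φ∈S) =
    inducedCopy φ φ-injective φ-preserves (λ i → S⊆T (φ∈S i))

  InducedCopy-prepend-edge : ∀ {a n S T q r} {F : Graph a} {H : Graph n} →
    q ∈ S → r ∈ S → adj G q r ≡ true → T ⊆ S ∩ nonNbr q ∩ nonNbr r →
    InducedCopy T (F ∪G H) → InducedCopy S ((K2 ∪G F) ∪G H)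
  InducedCopy-prepend-edge {S = S} {q = q} {r} {F} {H} q∈S r∈S qr T⊆
    (inducedCopy ψ ψ-injective ψ-preserves ψ∈T) = inducedCopy φ φ-injective φ-preserves φ∈S
    where
    φ : Fin (2 + _) → Fin m
    φ = q ∷ r ∷ ψ
    rq : adj G r q ≡ true
    rq = trans (Graph.sym G r q) qr
    q≁ψ : ∀ i → adj G q (ψ i) ≡ false
    q≁ψ i = proj₁ (proj₂ (T⊆ (ψ∈T i)))
    r≁ψ : ∀ i → adj G r (ψ i) ≡ false
    r≁ψ i = proj₂ (proj₂ (T⊆ (ψ∈T i)))
    φ-injective : Injective _≡_ _≡_ φ
    φ-injective {zero}        {zero}        _  = refl
    φ-injective {zero}        {suc zero}    eq = ⊥-elim (adjacent⇒distinct qr eq)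
    φ-injective {zero}        {suc (suc j)} eq = ⊥-elim (separated⇒distinct rq (r≁ψ j) eq)
    φ-injective {suc zero}    {zero}        eq = ⊥-elim (adjacent⇒distinct rq eq)
    φ-injective {suc zero}    {suc zero}    _  = refl
    φ-injective {suc zero}    {suc (suc j)} eq = ⊥-elim (separated⇒distinct qr (q≁ψ j) eq)
    φ-injective {suc (suc i)} {zero}        eq = ⊥-elim (separated⇒distinct rq (r≁ψ i) (sym eq))
    φ-injective {suc (suc i)} {suc zero}    eq = ⊥-elim (separated⇒distinct qr (q≁ψ i) (sym eq))
    φ-injective {suc (suc i)} {suc (suc j)} eq = cong (λ k → suc (suc k)) (ψ-injective eq)
    X = (K2 ∪G F) ∪G H
    flipped : ∀ {i j} → adj G (φ j) (φ i) ≡ adj X j i → adj G (φ i) (φ j) ≡ adj X i j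
    flipped {i} {j} eq = trans (Graph.sym G (φ i) (φ j)) (trans eq (Graph.sym X j i))
    q-ψ : ∀ j → adj G q (ψ j) ≡ adj X zero (suc (suc j))
    q-ψ j = trans (q≁ψ j) (sym (adj-K2∪-0 F H j))
    r-ψ : ∀ j → adj G r (ψ j) ≡ adj X (suc zero) (suc (suc j))
    r-ψ j = trans (r≁ψ j) (sym (adj-K2∪-1 F H j))
    φ-preserves : ∀ i j → adj G (φ i) (φ j) ≡ adj X i j
    φ-preserves zero          zero          = irrefl G q
    φ-preserves zero          (suc zero)    = qr
    φ-preserves zero          (suc (suc j)) = q-ψ j
    φ-preserves (suc zero)    zero          = rq
    φ-preserves (suc zero)    (suc zero)    = irrefl G r
    φ-preserves (suc zero)    (suc (suc j)) = r-ψ j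
    φ-preserves (suc (suc i)) zero          = flipped {suc (suc i)} {zero} (q-ψ i)
    φ-preserves (suc (suc i)) (suc zero)    = flipped {suc (suc i)} {suc zero} (r-ψ i)
    φ-preserves (suc (suc i)) (suc (suc j)) = trans (ψ-preserves i j) (sym (adj-K2∪-shift F H i j))
    φ∈S : ∀ i → φ i ∈ S
    φ∈S zero          = q∈S
    φ∈S (suc zero)    = r∈S
    φ∈S (suc (suc i)) = proj₁ (T⊆ (ψ∈T i))

  inducedSubgraph : ∀ {k} → (Fin k → Fin m) → Graph k
  inducedSubgraph φ = record
    { adj    = λ i j → adj G (φ i) (φ j)
    ; sym    = λ i j → Graph.sym G (φ i) (φ j)
    ; irrefl = λ i → irrefl G (φ i) }

  module _ (N : ℕ) where

    PK2HFreeOn : ℕ → VSet → Set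
    PK2HFreeOn p S = ∀ (H : Graph (suc N)) → maxDegree H ≡ N → ¬ InducedCopy S (pK2 p ∪G H)

    PK2HFreeOn-mono : ∀ {p S T} → S ⊆ T → PK2HFreeOn p T → PK2HFreeOn p S
    PK2HFreeOn-mono S⊆T free H maxDeg copy = free H maxDeg (InducedCopy-mono S⊆T copy)

    PK2HFreeOn-drop-edge : ∀ {p S T q r} → PK2HFreeOn (suc p) S →
      q ∈ S → r ∈ S → adj G q r ≡ true → T ⊆ S ∩ nonNbr q ∩ nonNbr r → PK2HFreeOn p T
    PK2HFreeOn-drop-edge free q∈S r∈S qr T⊆ H maxDeg copy =
      free H maxDeg (InducedCopy-prepend-edge q∈S r∈S qr T⊆ copy)

    PK2HFreeOn-0⇒sparse : ∀ {S v} → PK2HFreeOn 0 S → v ∈ S → ¬ HasNeighboursIn S v N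
    PK2HFreeOn-0⇒sparse {S} {v} free v∈S (φ , φ-injective , φ∈) =
      free H (maxDegree≡ H zero centre-degree) (inducedCopy (v ∷ φ) injective (λ _ _ → refl) inside)
      where
      H = inducedSubgraph (v ∷ φ)
      centre-degree : degree H zero ≡ N
      centre-degree = trans (degree≡sum-tabulate H zero)
        (cong₂ _+_ (cong indicator (irrefl G v)) (sum-tabulate-≡ N _ (λ j → cong indicator (proj₂ (φ∈ j)))))
      injective : Injective _≡_ _≡_ (v ∷ φ)
      injective {zero}  {zero}  _  = refl
      injective {zero}  {suc j} eq = ⊥-elim (adjacent⇒distinct (proj₂ (φ∈ j)) eq)
      injective {suc i} {zero}  eq = ⊥-elim (adjacent⇒distinct (proj₂ (φ∈ i)) (sym eq))
      injective {suc i} {suc j} eq = cong suc (φ-injective eq)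
      inside : ∀ i → (v ∷ φ) i ∈ S
      inside zero    = v∈S
      inside (suc i) = proj₁ (φ∈ i)

    open ColourBound N

    ColouringBound : ℕ → Set₁
    ColouringBound p = ∀ w {S} → Decidable S → PK2HFreeOn p S → ¬ CliqueIn S (suc w) → Colouring S (bound p w)

    colouring-nonNeighbours : ∀ {p} → ColouringBound p → ∀ {S q} → PK2HFreeOn (suc p) S → q ∈ S →
      ∀ l {U} → Decidable U → U ⊆ S → ¬ CliqueIn U (suc (suc l)) → CliqueIn (U ∩ nbr q) l →
      Colouring (U ∩ nonNbr q) (nonNeighbourBound p l)
    colouring-nonNeighbours IH free q∈S zero U? U⊆S no-clique _ =
      Colouring-edgeless (λ K → no-clique (CliqueIn-mono 2 proj₁ K))
    colouring-nonNeighbours {p} IH {q = q} free q∈S (suc l) {U} U? U⊆S no-clique (r , (r∈U , qr) , K) =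
      Colouring-split r
        (Colouring-mono (λ ((u∈U , qu) , ru) → (u∈U , ru) , qu)
          (colouring-nonNeighbours IH free q∈S l (U? ∩? nbr? r) (λ u∈ → U⊆S (proj₁ u∈))
            (λ K′ → no-clique (r , r∈U , K′))
            (CliqueIn-mono l (λ ((u∈U , qu) , ru) → (u∈U , ru) , qu) K)))
        (IH (suc (suc l)) ((U? ∩? nonNbr? q) ∩? nonNbr? r)
          (PK2HFreeOn-drop-edge {p} free q∈S (U⊆S r∈U) qr (λ ((u∈U , qu) , ru) → U⊆S u∈U , qu , ru))
          (λ K′ → no-clique (CliqueIn-mono (3 + l) (λ u∈ → proj₁ (proj₁ u∈)) K′)))

    colouring-bound-suc : ∀ {p} → ColouringBound p → ColouringBound (suc p)
    colouring-bound-suc IH zero    S? free no-vertex = Colouring-empty no-vertex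
    colouring-bound-suc {p} IH (suc w) S? free no-clique with cliqueIn? S? (suc w)
    ... | no no-smaller-clique =
      Colouring-weaken (m≤m+n _ _) (colouring-bound-suc IH w S? free no-smaller-clique)
    ... | yes (q , q∈S , K) = Colouring-split q
      (colouring-bound-suc IH w (S? ∩? nbr? q) (PK2HFreeOn-mono {suc p} proj₁ free)
        (λ K′ → no-clique (q , q∈S , K′)))
      (colouring-nonNeighbours IH free q∈S w S? (λ u∈S → u∈S) no-clique K)

    colouring-bound : ∀ p → ColouringBound p
    colouring-bound zero    w S? free _ = greedy-colouring S? N (PK2HFreeOn-0⇒sparse free)
    colouring-bound (suc p) = colouring-bound-suc (colouring-bound p)

Colouring⇒Colorable : ∀ {m} {G : Graph m} {k} → Colouring G U k → Colorable G k
Colouring⇒Colorable (colouring c c< c-proper) = (λ v → fromℕ< (c< {v} tt)) , λ i j ij eq →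
  c-proper tt tt ij (trans (sym (Fin.toℕ-fromℕ< _)) (trans (cong toℕ eq) (Fin.toℕ-fromℕ< _)))

mainTheorem16 : (p n : ℕ) → 1 ≤ p → 2 ≤ n →
    ∀ {m} (G : Graph m) → PK2HFree p n G →
    ∀ w → IsCliqueNumber G w → Colorable G (fBound p n w)
mainTheorem16 zero    _       ()  _
mainTheorem16 (suc p) zero    _   ()
mainTheorem16 (suc p) (suc N) _   _  G free w (_ , maximal) =
  Colouring⇒Colorable (subst (Colouring G U) (sym (fBound≡bound p w))
    (colouring-bound G N (suc p) w U? free-everywhere no-larger-clique))
  where
  open ColourBound N
  free-everywhere : PK2HFreeOn G N (suc p) U
  free-everywhere H maxDeg (inducedCopy φ φ-injective φ-preserves _) =
    free H maxDeg (φ , φ-injective , φ-preserves)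
  no-larger-clique : ¬ CliqueIn G U (suc w)
  no-larger-clique K = maximal (suc w) ≤-refl (CliqueIn⇒HasClique G (suc w) K)
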